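{- Let $\Theta=\exists\vec X\,\forall\vec Y\,\exists\vec Z\,\phi$ be a QBF with $\phi=\bigwedge_{i=1}^k C_i$. Then $\Theta$ is valid (true) if and only if its extension $\Theta^\uparrow$ is valid.
   Context: A QBF here is a formula $\exists\vec X\,\forall\vec Y\,\exists\vec Z\,\phi$ where $\vec X,\vec Y,\vec Z$ are disjoint sets of propositional atoms and $\phi=\bigwedge_{i=1}^kC_i$ is a CNF over $\vec X\cup\vec Y\cup\vec Z$, each clause a disjunction of literals. The extension of $\Theta$ is $\Theta^\uparrow=\exists\vec X\,\forall(\vec Y\cup\vec V)\,\exists\vec Z\,\bigwedge_{i=1}^k(v_i\vee C_i)$, where $\vec V=\{v_1,\ldots,v_k\}$ are fresh atoms. -}

module Defs where

open import Data.Nat using (ℕ; _≟_)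
open import Data.Bool using (Bool; true; false; if_then_else_; not)
open import Data.List using (List; []; _∷_; _++_; length; zipWith)
open import Data.List.Relation.Unary.All using (All)
open import Data.List.Relation.Unary.Any using (Any)
open import Data.List.Relation.Unary.Unique.Propositional using (Unique)
open import Data.List.Membership.Propositional using (_∈_; _∉_)
open import Data.List.Membership.DecPropositional _≟_ using (_∈?_)
open import Data.Product using (Σ; _×_)
open import Relation.Nullary using (does)
open import Relation.Binary.PropositionalEquality using (_≡_)

Atom : Set
Atom = ℕ

data Literal : Set where
  pos : Atom → Literal
  neg : Atom → Literal

atomOf : Literal → Atom
atomOf (pos a) = a
atomOf (neg a) = a

Clause : Set
Clause = List Literal

CNF : Set
CNF = List Clause

Assignment : Set
Assignment = Atom → Bool

litTrue : Assignment → Literal → Set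
litTrue ρ (pos a) = ρ a ≡ true
litTrue ρ (neg a) = ρ a ≡ false

clauseTrue : Assignment → Clause → Set
clauseTrue ρ C = Any (litTrue ρ) C

cnfTrue : Assignment → CNF → Set
cnfTrue ρ φ = All (clauseTrue ρ) φ

Disjoint : List Atom → List Atom → Set
Disjoint A B = ∀ a → a ∈ A → a ∉ B

record QBF : Set where
  field
    X Y Z : List Atom
    φ     : CNF
    disjXY : Disjoint X Y
    disjXZ : Disjoint X Z
    disjYZ : Disjoint Y Z
    over   : All (All (λ l → atomOf l ∈ (X ++ Y ++ Z))) φ

combine : List Atom → List Atom → Assignment → Assignment → Assignment → Assignment
combine X Y αX αY αZ a =
  if does (a ∈? X) then αX a else (if does (a ∈? Y) then αY a else αZ a)

ValidPrefix : List Atom → List Atom → List Atom → CNF → Set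
ValidPrefix X Y Z φ =
  Σ Assignment λ αX → ∀ (αY : Assignment) → Σ Assignment λ αZ →
    cnfTrue (combine X Y αX αY αZ) φ

Valid : QBF → Set
Valid Θ = ValidPrefix X Y Z φ
  where open QBF Θ

FreshFor : QBF → List Atom → Set
FreshFor Θ V =
  (length V ≡ length φ) × Unique V × Disjoint V (X ++ Y ++ Z)
  where open QBF Θ

extendCNF : List Atom → CNF → CNF
extendCNF V φ = zipWith (λ v C → pos v ∷ C) V φ

ValidExtension : QBF → List Atom → Set
ValidExtension Θ V = ValidPrefix X (Y ++ V) Z (extendCNF V φ)
  where open QBF Θ

-- Every clause vᵢ ∨ Cᵢ is weaker than Cᵢ, and the atoms vᵢ do not occur in φ, so a winning
-- strategy for Θ wins Θ↑ by ignoring V. Conversely, once the universal player sets every vᵢ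
-- false the extended matrix is equivalent to φ, so a strategy for Θ↑ answers a move on Y as
-- if V had been played false.
module Submission where

open import Defs
open import Data.Bool using (false; if_then_else_)
open import Data.List using (List; []; _∷_; _++_; length)
open import Data.List.Relation.Unary.All as All using (All; []; _∷_)
open import Data.List.Relation.Unary.Any using (here; there)
open import Data.List.Membership.Propositional using (_∈_; _∉_)
open import Data.List.Membership.Propositional.Properties using (∈-++⁺ˡ; ∈-++⁺ʳ; ∈-++⁻)
open import Data.Nat using (_≟_)
open import Data.List.Membership.DecPropositional _≟_ using (_∈?_)
open import Data.Nat.Properties using (suc-injective)
open import Data.Product using (Σ; _,_; proj₁; proj₂)
open import Data.Sum using ([_,_]′)
open import Function.Bundles using (_⇔_; mk⇔)
open import Relation.Nullary using (does; yes; no)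
open import Relation.Nullary.Decidable using (dec-true; dec-false)
open import Relation.Binary.PropositionalEquality using (_≡_; refl; sym; trans; cong)

Avoids : CNF → List Atom → Set
Avoids φ V = All (All (λ l → atomOf l ∉ V)) φ

litTrue-cong : ∀ {ρ σ} l → ρ (atomOf l) ≡ σ (atomOf l) → litTrue ρ l → litTrue σ l
litTrue-cong (pos a) ρa≡σa ρa≡b = trans (sym ρa≡σa) ρa≡b
litTrue-cong (neg a) ρa≡σa ρa≡b = trans (sym ρa≡σa) ρa≡b

clauseTrue-cong : ∀ {P : Atom → Set} {ρ σ} → (∀ {a} → P a → ρ a ≡ σ a) →
                  ∀ {C} → All (λ l → P (atomOf l)) C → clauseTrue ρ C → clauseTrue σ C
clauseTrue-cong agree (Pl ∷ _)  (here l-true) = here (litTrue-cong _ (agree Pl) l-true)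
clauseTrue-cong agree (_ ∷ PC) (there C-true) = there (clauseTrue-cong agree PC C-true)

cnfTrue-cong : ∀ {P : Atom → Set} {ρ σ} → (∀ {a} → P a → ρ a ≡ σ a) →
               ∀ {φ} → All (All (λ l → P (atomOf l))) φ → cnfTrue ρ φ → cnfTrue σ φ
cnfTrue-cong agree Pφ φ-true =
  All.zipWith (λ (PC , C-true) → clauseTrue-cong agree PC C-true) (Pφ , φ-true)

cnfTrue-extendCNF⁺ : ∀ {ρ} V φ → cnfTrue ρ φ → cnfTrue ρ (extendCNF V φ)
cnfTrue-extendCNF⁺ []      _       _                 = []
cnfTrue-extendCNF⁺ (_ ∷ _) []      _                 = []
cnfTrue-extendCNF⁺ (_ ∷ V) (_ ∷ φ) (C-true ∷ φ-true) = there C-true ∷ cnfTrue-extendCNF⁺ V φ φ-true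

cnfTrue-extendCNF⁻ : ∀ {ρ} V φ → length V ≡ length φ → All (λ v → ρ v ≡ false) V →
                     cnfTrue ρ (extendCNF V φ) → cnfTrue ρ φ
cnfTrue-extendCNF⁻ []      []      _       _                   _ = []
cnfTrue-extendCNF⁻ (_ ∷ V) (_ ∷ φ) |V|≡|φ| (v-false ∷ V-false) (here v-true ∷ _)
  with () ← trans (sym v-true) v-false
cnfTrue-extendCNF⁻ (_ ∷ V) (_ ∷ φ) |V|≡|φ| (_ ∷ V-false) (there C-true ∷ φ↑-true) =
  C-true ∷ cnfTrue-extendCNF⁻ V φ (suc-injective |V|≡|φ|) V-false φ↑-true

falseOn : List Atom → Assignment → Assignment
falseOn V α a = if does (a ∈? V) then false else α a

falseOn-∈ : ∀ {V α a} → a ∈ V → falseOn V α a ≡ false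
falseOn-∈ {V} {a = a} a∈V rewrite dec-true (a ∈? V) a∈V = refl

falseOn-∉ : ∀ {V α a} → a ∉ V → falseOn V α a ≡ α a
falseOn-∉ {V} {a = a} a∉V rewrite dec-false (a ∈? V) a∉V = refl

does-∈?-++ˡ : ∀ {Y V a} → a ∉ V → does (a ∈? Y ++ V) ≡ does (a ∈? Y)
does-∈?-++ˡ {Y} {V} {a} a∉V with a ∈? Y
... | yes a∈Y = dec-true (a ∈? Y ++ V) (∈-++⁺ˡ a∈Y)
... | no  a∉Y = dec-false (a ∈? Y ++ V) λ a∈Y++V → [ a∉Y , a∉V ]′ (∈-++⁻ Y a∈Y++V)

module _ (X Y : List Atom) (αX αY αZ : Assignment) {a : Atom} where

  combine-congʸ : ∀ βY → αY a ≡ βY a → combine X Y αX αY αZ a ≡ combine X Y αX βY αZ a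
  combine-congʸ _ = cong (λ b → combine X Y αX (λ _ → b) αZ a)

  combine-∈ʸ : a ∉ X → a ∈ Y → combine X Y αX αY αZ a ≡ αY a
  combine-∈ʸ a∉X a∈Y rewrite dec-false (a ∈? X) a∉X | dec-true (a ∈? Y) a∈Y = refl

  combine-++-∉ : ∀ {V} → a ∉ V → combine X (Y ++ V) αX αY αZ a ≡ combine X Y αX αY αZ a
  combine-++-∉ {V} a∉V rewrite does-∈?-++ˡ {Y} a∉V = refl

validPrefix-extend⁺ : ∀ {X Y Z V φ} → Avoids φ V →
                      ValidPrefix X Y Z φ → ValidPrefix X (Y ++ V) Z (extendCNF V φ)
validPrefix-extend⁺ {X} {Y} {V = V} {φ} φ#V (αX , strategy) = αX , λ αY →
  let αZ , φ-true = strategy αY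
  in  αZ , cnfTrue-extendCNF⁺ V φ
               (cnfTrue-cong (λ a∉V → sym (combine-++-∉ X Y αX αY αZ a∉V)) φ#V φ-true)

validPrefix-extend⁻ : ∀ {X Y Z V φ} → length V ≡ length φ → Disjoint V X → Avoids φ V →
                      ValidPrefix X (Y ++ V) Z (extendCNF V φ) → ValidPrefix X Y Z φ
validPrefix-extend⁻ {X} {Y} {Z} {V} {φ} |V|≡|φ| V#X φ#V (αX , strategy) = αX , respond
  where
  respond : ∀ αY → Σ Assignment λ αZ → cnfTrue (combine X Y αX αY αZ) φ
  respond αY = αZ , cnfTrue-cong agree φ#V (cnfTrue-extendCNF⁻ V φ |V|≡|φ| V-false φ↑-true)
    where
    αZ = proj₁ (strategy (falseOn V αY))
    ρ↑ = combine X (Y ++ V) αX (falseOn V αY) αZ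
    φ↑-true : cnfTrue ρ↑ (extendCNF V φ)
    φ↑-true = proj₂ (strategy (falseOn V αY))
    V-false : All (λ v → ρ↑ v ≡ false) V
    V-false = All.tabulate λ v∈V →
      trans (combine-∈ʸ X (Y ++ V) αX (falseOn V αY) αZ (V#X _ v∈V) (∈-++⁺ʳ Y v∈V))
            (falseOn-∈ {α = αY} v∈V)
    agree : ∀ {a} → a ∉ V → ρ↑ a ≡ combine X Y αX αY αZ a
    agree a∉V = trans (combine-congʸ X (Y ++ V) αX (falseOn V αY) αZ αY (falseOn-∉ {α = αY} a∉V))
                      (combine-++-∉ X Y αX αY αZ a∉V)

mainTheorem4 : (Θ : QBF) (V : List Atom) → FreshFor Θ V → Valid Θ ⇔ ValidExtension Θ V
mainTheorem4 Θ V (|V|≡|φ| , _ , V#XYZ) =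
  mk⇔ (validPrefix-extend⁺ {X} {Y} {Z} φ#V) (validPrefix-extend⁻ {X} {Y} {Z} |V|≡|φ| V#X φ#V)
  where
  open QBF Θ
  φ#V : Avoids φ V
  φ#V = All.map (All.map λ a∈XYZ a∈V → V#XYZ _ a∈V a∈XYZ) over
  V#X : Disjoint V X
  V#X v v∈V v∈X = V#XYZ v v∈V (∈-++⁺ˡ v∈X)
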